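{- Suppose there exists a $(k\times n, n)$-near triple array. Then there exist an $((n-k)\times n, n)$-near triple array and an $((n-k)\times(n-1), n)$-near triple array.
   Context: An $r\times c$ row-column design on $v$ symbols is an $r\times c$ array each of whose cells is filled with one of $v$ symbols. It is binary if no symbol occurs more than once in any row or in any column. Let $e=rc/v$, $e^-=\lfloor e\rfloor$, $e^+=\lceil e\rceil$. The design is equireplicate if $e$ is an integer and every symbol occurs exactly $e$ times, and near equireplicate if $e$ is not an integer and every symbol occurs $e^-$ or $e^+$ times. For a binary design, let $R_i$, $C_j$ be the symbol sets of row $i$ and column $j$, and put $\lambda_{rc}=\frac{1}{rc}\sum_{i,j}|R_i\cap C_j|$, $\lambda_{rr}=\binom{r}{2}^{ -1}\sum_{i<j}|R_i\cap R_j|$, $\lambda_{cc}=\binom{c}{2}^{ -1}\sum_{i<j}|C_i\cap C_j|$; for real $x$, $x^-=\lfloor x\rfloor$, $x^+=\lceil x\rceil$. An $(r\times c,v)$-near triple array is a binary $r\times c$ row-column design on $v$ symbols which is equireplicate or near equireplicate and in which every row and column share $\lambda_{rc}^-$ or $\lambda_{rc}^+$ symbols, every two distinct rows share $\lambda_{rr}^-$ or $\lambda_{rr}^+$ symbols, and every two distinct columns share $\lambda_{cc}^-$ or $\lambda_{cc}^+$ symbols. -}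

module Defs where

open import Data.Nat using (ℕ; zero; suc; _+_; _*_; _∸_; _<_; _≤_) renaming (_<?_ to _<?ⁿ_)
open import Data.Nat.DivMod using (_/_)
open import Data.Nat.Combinatorics using (_C_)
open import Data.Fin using (Fin; toℕ)
open import Data.Fin.Properties using (any?) renaming (_≟_ to _≟ᶠ_)
open import Data.Product using (∃; Σ; _×_; _,_)
open import Data.Sum using (_⊎_)
open import Function using (_∘_; Injective)
open import Relation.Nullary using (Dec; yes; no; ¬_)
open import Relation.Nullary.Decidable using (_×-dec_)
open import Relation.Binary.PropositionalEquality using (_≡_)

∑ : ∀ {n} → (Fin n → ℕ) → ℕ
∑ {zero}  f = 0
∑ {suc n} f = f Fin.zero + ∑ (f ∘ Fin.suc)

𝟙 : ∀ {p} {P : Set p} → Dec P → ℕ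
𝟙 (yes _) = 1
𝟙 (no _)  = 0

-- floor and ceiling of S / N (the value for N = 0 is irrelevant: it is
-- only used when there is at least one item being averaged)
⌊_/_⌋ : ℕ → ℕ → ℕ
⌊ S / zero  ⌋ = 0
⌊ S / suc n ⌋ = S / suc n

⌈_/_⌉ : ℕ → ℕ → ℕ
⌈ S / zero  ⌉ = 0
⌈ S / suc n ⌉ = (S + n) / suc n

FloorOrCeil : ℕ → ℕ → ℕ → Set
FloorOrCeil x S N = x ≡ ⌊ S / N ⌋ ⊎ x ≡ ⌈ S / N ⌉

Design : ℕ → ℕ → ℕ → Set
Design r c v = Fin r → Fin c → Fin v

module _ {r c v : ℕ} (A : Design r c v) where

  Binary : Set
  Binary = (∀ i → Injective _≡_ _≡_ (λ j → A i j))
         × (∀ j → Injective _≡_ _≡_ (λ i → A i j))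

  occ : Fin v → ℕ
  occ s = ∑ λ i → ∑ λ j → 𝟙 (A i j ≟ᶠ s)

  EquiOrNearEqui : Set
  EquiOrNearEqui = ∀ s → FloorOrCeil (occ s) (r * c) v

  -- symbol sets R_i, C_j (as decidable membership)
  inRow? : (i : Fin r) (s : Fin v) → Dec (∃ λ j → A i j ≡ s)
  inRow? i s = any? (λ j → A i j ≟ᶠ s)

  inCol? : (j : Fin c) (s : Fin v) → Dec (∃ λ i → A i j ≡ s)
  inCol? j s = any? (λ i → A i j ≟ᶠ s)

  rc∩ : Fin r → Fin c → ℕ
  rc∩ i j = ∑ λ s → 𝟙 (inRow? i s ×-dec inCol? j s)

  rr∩ : Fin r → Fin r → ℕ
  rr∩ i i' = ∑ λ s → 𝟙 (inRow? i s ×-dec inRow? i' s)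

  cc∩ : Fin c → Fin c → ℕ
  cc∩ j j' = ∑ λ s → 𝟙 (inCol? j s ×-dec inCol? j' s)

  -- sums defining λ_rc = Σrc / (rc), λ_rr = Σrr / (r C 2), λ_cc = Σcc / (c C 2)
  Σrc : ℕ
  Σrc = ∑ λ i → ∑ λ j → rc∩ i j

  Σrr : ℕ
  Σrr = ∑ λ i → ∑ λ i' → 𝟙 (toℕ i <?ⁿ toℕ i') * rr∩ i i'

  Σcc : ℕ
  Σcc = ∑ λ j → ∑ λ j' → 𝟙 (toℕ j <?ⁿ toℕ j') * cc∩ j j'

  record IsNearTripleArray : Set where
    field
      binary : Binary
      replication : EquiOrNearEqui
      rowCol : ∀ i j → FloorOrCeil (rc∩ i j) Σrc (r * c)
      rowRow : ∀ i i' → ¬ i ≡ i' → FloorOrCeil (rr∩ i i') Σrr (r C 2)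
      colCol : ∀ j j' → ¬ j ≡ j' → FloorOrCeil (cc∩ j j') Σcc (c C 2)

NearTripleArrayExists : ℕ → ℕ → ℕ → Set
NearTripleArrayExists r c v = Σ (Design r c v) IsNearTripleArray

-- The rows of a (k × n, n)-near triple array A are permutations, so A is a Latin rectangle.
-- Hall's theorem (in Rado's edge-deletion form), applied to the regular bipartite graph joining
-- each column to the symbols it still misses, completes A to a Latin square; let B be the n − k
-- added rows.  The rows of B are permutations, so its replication numbers and its row–column and
-- row–row intersection sizes are constant, while its columns complement those of A, so that
-- |C_j ∩ C_j′| for B is n − 2k plus the same quantity for A and stays within one of its mean.
-- Deleting the first column of B removes one symbol from each row, which moves every count by at
-- most one; and any family of naturals whose values differ by at most one consists of floors and
-- ceilings of its mean.

module Submission where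

open import Defs
open import Data.Bool using (Bool; true; false; T; not; _∧_; _∨_)
open import Data.Bool.Properties using (T-≡; T-∧; T-∨)
open import Data.Empty using (⊥; ⊥-elim)
open import Data.Fin using (Fin; toℕ)
open import Data.Fin.Properties using (any?) renaming (_≟_ to _≟ᶠ_)
import Data.Fin.Properties as Finₚ
open import Data.Fin.Subset.Properties using (anySubset?)
open import Data.Nat using (ℕ; zero; suc; pred; _+_; _*_; _∸_; _<_; _≤_; z≤n; s≤s; z<s;
  _≟_; _≤?_; NonZero; >-nonZero) renaming (_<?_ to _<?ⁿ_)
open import Data.Nat.Combinatorics using (_C_; nC1≡n; nCk+nC[k+1]≡[n+1]C[k+1])
open import Data.Nat.DivMod using (_/_; m*n/n≡m; m<n*o⇒m/o<n; /-monoˡ-≤; m/n≡1+[m∸n]/n)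
open import Data.Nat.Induction using (<-wellFounded)
open import Data.Nat.Properties
open import Algebra.Properties.CommutativeSemigroup +-commutativeSemigroup using (interchange)
open import Data.Product using (∃; ∃₂; Σ; _×_; _,_; proj₁; proj₂)
open import Data.Sum using (_⊎_; inj₁; inj₂; swap)
open import Data.Vec using (lookup; tabulate)
open import Data.Vec.Functional using (_∷_)
open import Data.Vec.Properties using (lookup∘tabulate)
open import Function using (_∘_)
open import Function.Bundles using (Equivalence)
open import Function.Definitions using (Injective)
open import Induction.WellFounded using (Acc; acc)
open import Relation.Binary.Definitions using (tri<; tri≈; tri>)
open import Relation.Binary.PropositionalEquality
open import Relation.Nullary using (Dec; yes; no; ¬_)
open import Relation.Nullary.Decidable
  using (_×-dec_; ¬?; isYes; T?; fromWitness; toWitness; fromWitnessFalse; toWitnessFalse)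

private
  variable
    n : ℕ

𝟙-yes : ∀ {p} {P : Set p} (d : Dec P) → P → 𝟙 d ≡ 1
𝟙-yes (yes _) _ = refl
𝟙-yes (no ¬x) x = ⊥-elim (¬x x)

𝟙-no : ∀ {p} {P : Set p} (d : Dec P) → ¬ P → 𝟙 d ≡ 0
𝟙-no (yes x) ¬x = ⊥-elim (¬x x)
𝟙-no (no _) _ = refl

𝟙≤1 : ∀ {p} {P : Set p} (d : Dec P) → 𝟙 d ≤ 1
𝟙≤1 (yes _) = s≤s z≤n
𝟙≤1 (no _) = z≤n

𝟙≡1⇒ : ∀ {p} {P : Set p} (d : Dec P) → 𝟙 d ≡ 1 → P
𝟙≡1⇒ (yes x) _ = x

𝟙-cong : ∀ {p q} {P : Set p} {Q : Set q} (d : Dec P) (e : Dec Q) → (P → Q) → (Q → P) → 𝟙 d ≡ 𝟙 e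
𝟙-cong (yes x) e to _ = sym (𝟙-yes e (to x))
𝟙-cong (no ¬x) e _ from = sym (𝟙-no e (¬x ∘ from))

𝟙-×-dec : ∀ {p q} {P : Set p} {Q : Set q} (d : Dec P) (e : Dec Q) → 𝟙 (d ×-dec e) ≡ 𝟙 d * 𝟙 e
𝟙-×-dec (yes _) (yes _) = refl
𝟙-×-dec (yes _) (no _) = refl
𝟙-×-dec (no _) _ = refl

𝟙-×-dec-comm : ∀ {p q} {P : Set p} {Q : Set q} (d : Dec P) (e : Dec Q) → 𝟙 (d ×-dec e) ≡ 𝟙 (e ×-dec d)
𝟙-×-dec-comm d e = trans (𝟙-×-dec d e) (trans (*-comm (𝟙 d) (𝟙 e)) (sym (𝟙-×-dec e d)))

∑-cong : {f g : Fin n → ℕ} → (∀ i → f i ≡ g i) → ∑ f ≡ ∑ g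
∑-cong {zero} _ = refl
∑-cong {suc n} f≗g = cong₂ _+_ (f≗g Fin.zero) (∑-cong (f≗g ∘ Fin.suc))

∑-mono-≤ : {f g : Fin n → ℕ} → (∀ i → f i ≤ g i) → ∑ f ≤ ∑ g
∑-mono-≤ {zero} _ = z≤n
∑-mono-≤ {suc n} f≤g = +-mono-≤ (f≤g Fin.zero) (∑-mono-≤ (f≤g ∘ Fin.suc))

∑-mono-< : {f g : Fin n → ℕ} → (∀ i → f i ≤ g i) → ∀ i → f i < g i → ∑ f < ∑ g
∑-mono-< f≤g Fin.zero fᵢ<gᵢ = +-mono-<-≤ fᵢ<gᵢ (∑-mono-≤ (f≤g ∘ Fin.suc))
∑-mono-< f≤g (Fin.suc i) fᵢ<gᵢ = +-mono-≤-< (f≤g Fin.zero) (∑-mono-< (f≤g ∘ Fin.suc) i fᵢ<gᵢ)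

∑-const : ∀ c → ∑ {n} (λ _ → c) ≡ n * c
∑-const {zero} c = refl
∑-const {suc n} c = cong (c +_) (∑-const {n} c)

∑-const-1 : ∑ {n} (λ _ → 1) ≡ n
∑-const-1 {n} = trans (∑-const {n} 1) (*-identityʳ n)

∑-zero : {f : Fin n → ℕ} → (∀ i → f i ≡ 0) → ∑ f ≡ 0
∑-zero {n} f≗0 = trans (∑-cong f≗0) (trans (∑-const {n} 0) (*-zeroʳ n))

∑-distrib-+ : (f g : Fin n → ℕ) → ∑ (λ i → f i + g i) ≡ ∑ f + ∑ g
∑-distrib-+ {zero} f g = refl
∑-distrib-+ {suc n} f g =
  trans (cong (f Fin.zero + g Fin.zero +_) (∑-distrib-+ (f ∘ Fin.suc) (g ∘ Fin.suc)))
        (interchange (f Fin.zero) (g Fin.zero) _ _)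

∑-*ˡ : ∀ c (f : Fin n → ℕ) → ∑ (λ i → c * f i) ≡ c * ∑ f
∑-*ˡ {zero} c f = sym (*-zeroʳ c)
∑-*ˡ {suc n} c f = trans (cong (c * f Fin.zero +_) (∑-*ˡ c (f ∘ Fin.suc))) (sym (*-distribˡ-+ c _ _))

∑-*ʳ : ∀ c (f : Fin n → ℕ) → ∑ (λ i → f i * c) ≡ ∑ f * c
∑-*ʳ c f = trans (∑-cong (λ i → *-comm (f i) c)) (trans (∑-*ˡ c f) (*-comm c (∑ f)))

∑-comm : ∀ {m} (f : Fin m → Fin n → ℕ) → ∑ (λ i → ∑ (λ j → f i j)) ≡ ∑ (λ j → ∑ (λ i → f i j))
∑-comm {n} {m = zero} f = sym (∑-zero {n} (λ _ → refl))
∑-comm {m = suc m} f = trans (cong (∑ (f Fin.zero) +_) (∑-comm (f ∘ Fin.suc)))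
                             (sym (∑-distrib-+ (f Fin.zero) _))

∑-δ : (t : Fin n) (g : Fin n → ℕ) → ∑ (λ s → 𝟙 (t ≟ᶠ s) * g s) ≡ g t
∑-δ {suc n} Fin.zero g =
  trans (cong₂ _+_ (+-identityʳ (g Fin.zero)) (∑-zero {n} (λ _ → refl))) (+-identityʳ _)
∑-δ {suc n} (Fin.suc t) g =
  trans (∑-cong λ s → cong (_* g (Fin.suc s))
                            (𝟙-cong (Fin.suc t ≟ᶠ Fin.suc s) (t ≟ᶠ s) Finₚ.suc-injective (cong Fin.suc)))
        (∑-δ t (g ∘ Fin.suc))

∑-δ-1 : (t : Fin n) → ∑ (λ s → 𝟙 (t ≟ᶠ s)) ≡ 1
∑-δ-1 t = trans (∑-cong (λ s → sym (*-identityʳ (𝟙 (t ≟ᶠ s))))) (∑-δ t (λ _ → 1))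

∑≡n⇒≡1 : (f : Fin n → ℕ) → (∀ i → f i ≤ 1) → ∑ f ≡ n → ∀ i → f i ≡ 1
∑≡n⇒≡1 f f≤1 ∑f≡n i with f i ≟ 1
... | yes fᵢ≡1 = fᵢ≡1
... | no fᵢ≢1 = ⊥-elim (<-irrefl (trans ∑f≡n (sym ∑-const-1)) (∑-mono-< f≤1 i (≤∧≢⇒< (f≤1 i) fᵢ≢1)))

∑-complement : (f g : Fin n → ℕ) → (∀ i → f i + g i ≡ 1) → ∑ f + ∑ g ≡ n
∑-complement f g f+g≡1 = trans (sym (∑-distrib-+ f g)) (trans (∑-cong f+g≡1) ∑-const-1)

+≡1⇒ : ∀ a b → a + b ≡ 1 → (a ≡ 0 × b ≡ 1) ⊎ (a ≡ 1 × b ≡ 0)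
+≡1⇒ zero b a+b≡1 = inj₁ (refl , a+b≡1)
+≡1⇒ (suc a) b a+b≡1 = inj₂ (cong suc (m+n≡0⇒m≡0 a (suc-injective a+b≡1)) , m+n≡0⇒n≡0 a (suc-injective a+b≡1))

complement-∩-pointwise : ∀ a b a′ b′ → a + b ≡ 1 → a′ + b′ ≡ 1 → b * b′ + (a + a′) ≡ 1 + a * a′
complement-∩-pointwise a b a′ b′ a+b≡1 a′+b′≡1 with +≡1⇒ a b a+b≡1 | +≡1⇒ a′ b′ a′+b′≡1
... | inj₁ (refl , refl) | inj₁ (refl , refl) = refl
... | inj₁ (refl , refl) | inj₂ (refl , refl) = refl
... | inj₂ (refl , refl) | inj₁ (refl , refl) = refl
... | inj₂ (refl , refl) | inj₂ (refl , refl) = refl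

∑-complement-∩ : (a b a′ b′ : Fin n → ℕ) → (∀ s → a s + b s ≡ 1) → (∀ s → a′ s + b′ s ≡ 1) →
                 ∑ (λ s → b s * b′ s) + (∑ a + ∑ a′) ≡ n + ∑ (λ s → a s * a′ s)
∑-complement-∩ {n} a b a′ b′ a+b≡1 a′+b′≡1 = begin
  ∑ (λ s → b s * b′ s) + (∑ a + ∑ a′)        ≡⟨ cong (∑ (λ s → b s * b′ s) +_) (∑-distrib-+ a a′) ⟨
  ∑ (λ s → b s * b′ s) + ∑ (λ s → a s + a′ s) ≡⟨ ∑-distrib-+ (λ s → b s * b′ s) _ ⟨
  ∑ (λ s → b s * b′ s + (a s + a′ s))        ≡⟨ ∑-cong (λ s → complement-∩-pointwise (a s) (b s) (a′ s) (b′ s)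
                                                                                 (a+b≡1 s) (a′+b′≡1 s)) ⟩
  ∑ (λ s → 1 + a s * a′ s)                   ≡⟨ ∑-distrib-+ (λ _ → 1) (λ s → a s * a′ s) ⟩
  ∑ {n} (λ _ → 1) + ∑ (λ s → a s * a′ s)     ≡⟨ cong (_+ ∑ (λ s → a s * a′ s)) ∑-const-1 ⟩
  n + ∑ (λ s → a s * a′ s)                   ∎
  where open ≡-Reasoning

∑∑ : ∀ {a b} → (Fin a → Fin b → ℕ) → ℕ
∑∑ f = ∑ λ i → ∑ λ j → f i j

module _ {a b : ℕ} where

  ∑∑-mono-< : {f g : Fin a → Fin b → ℕ} → (∀ i j → f i j ≤ g i j) →
              ∀ i j → f i j < g i j → ∑∑ f < ∑∑ g
  ∑∑-mono-< f≤g i j fᵢⱼ<gᵢⱼ = ∑-mono-< (λ i → ∑-mono-≤ (f≤g i)) i (∑-mono-< (f≤g i) j fᵢⱼ<gᵢⱼ)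

  ∑∑-distrib-+ : (f g : Fin a → Fin b → ℕ) → ∑∑ (λ i j → f i j + g i j) ≡ ∑∑ f + ∑∑ g
  ∑∑-distrib-+ f g = trans (∑-cong (λ i → ∑-distrib-+ (f i) (g i))) (∑-distrib-+ {a} _ _)

  ∑∑-*ʳ : ∀ c (f : Fin a → Fin b → ℕ) → ∑∑ (λ i j → f i j * c) ≡ ∑∑ f * c
  ∑∑-*ʳ c f = trans (∑-cong (λ i → ∑-*ʳ c (f i))) (∑-*ʳ {a} c _)

-- Injective maps and Latin rectangles

count-injective : ∀ {m} (f : Fin m → Fin n) → Injective _≡_ _≡_ f →
                  ∀ s → ∑ (λ i → 𝟙 (f i ≟ᶠ s)) ≡ 𝟙 (any? λ i → f i ≟ᶠ s)
count-injective {m = zero} f f-inj s = refl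
count-injective {m = suc m} f f-inj s
  with f Fin.zero ≟ᶠ s | count-injective (f ∘ Fin.suc) (Finₚ.suc-injective ∘ f-inj) s
... | yes f₀≡s | tail =
  cong suc (trans tail (𝟙-no _ λ (i , fᵢ₊₁≡s) → Finₚ.0≢1+n (f-inj (trans f₀≡s (sym fᵢ₊₁≡s)))))
... | no f₀≢s | tail =
  trans tail (𝟙-cong _ _ (λ (i , fᵢ₊₁≡s) → Fin.suc i , fᵢ₊₁≡s)
                         λ { (Fin.zero , f₀≡s) → ⊥-elim (f₀≢s f₀≡s) ; (Fin.suc i , fᵢ₊₁≡s) → i , fᵢ₊₁≡s })

module _ {m : ℕ} (f : Fin m → Fin n) where

  ∑-count : ∑ (λ s → ∑ (λ i → 𝟙 (f i ≟ᶠ s))) ≡ m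
  ∑-count = trans (sym (∑-comm (λ i s → 𝟙 (f i ≟ᶠ s))))
                  (trans (∑-cong (λ i → ∑-δ-1 (f i))) ∑-const-1)

  image-size-injective : Injective _≡_ _≡_ f → ∑ (λ s → 𝟙 (any? λ i → f i ≟ᶠ s)) ≡ m
  image-size-injective f-inj = trans (sym (∑-cong (count-injective f f-inj))) ∑-count

injective⇒surjective : (f : Fin n → Fin n) → Injective _≡_ _≡_ f → ∀ s → ∃ λ i → f i ≡ s
injective⇒surjective f f-inj s =
  𝟙≡1⇒ (any? λ i → f i ≟ᶠ s) (∑≡n⇒≡1 _ (λ s → 𝟙≤1 _) (image-size-injective f f-inj) s)

module LatinRectangle {r : ℕ} (L : Design r n n) (L-bin : Binary L) where

  𝟙-inRow : ∀ i s → 𝟙 (inRow? L i s) ≡ 1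
  𝟙-inRow i s = 𝟙-yes _ (injective⇒surjective (L i) (proj₁ L-bin i) s)

  count-row : ∀ i s → ∑ (λ j → 𝟙 (L i j ≟ᶠ s)) ≡ 1
  count-row i s = trans (count-injective (L i) (proj₁ L-bin i) s) (𝟙-inRow i s)

  occ-latin : ∀ s → occ L s ≡ r
  occ-latin s = trans (∑-cong (λ i → count-row i s)) ∑-const-1

  column-size : ∀ j → ∑ (λ s → 𝟙 (inCol? L j s)) ≡ r
  column-size j = image-size-injective (λ i → L i j) (proj₂ L-bin j)

  columns-containing : ∀ s → ∑ (λ j → 𝟙 (inCol? L j s)) ≡ r
  columns-containing s = begin
    ∑ (λ j → 𝟙 (inCol? L j s))             ≡⟨ ∑-cong (λ j → count-injective (λ i → L i j) (proj₂ L-bin j) s) ⟨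
    ∑ (λ j → ∑ (λ i → 𝟙 (L i j ≟ᶠ s)))     ≡⟨ ∑-comm (λ j i → 𝟙 (L i j ≟ᶠ s)) ⟩
    occ L s                                  ≡⟨ occ-latin s ⟩
    r                                        ∎
    where open ≡-Reasoning

-- Floors and ceilings of means

/-between : ∀ {m q d} .{{_ : NonZero d}} → q * d ≤ m → m < suc q * d → m / d ≡ q
/-between {m} {q} {d} lo hi =
  ≤-antisym (m<1+n⇒m≤n (m<n*o⇒m/o<n hi)) (subst (_≤ m / d) (m*n/n≡m q d) (/-monoˡ-≤ d lo))

floorOrCeil-intro : ∀ {x S N} → x * N < S + N → S < suc x * N → FloorOrCeil x S N
floorOrCeil-intro {x} {S} {zero} _ hi = ⊥-elim (n≮0 (subst (S <_) (*-zeroʳ (suc x)) hi))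
floorOrCeil-intro {x} {S} {suc n} lo hi with x * suc n ≤? S
... | yes x*N≤S = inj₁ (sym (/-between x*N≤S hi))
... | no x*N≰S = inj₂ (sym (/-between (m<1+n⇒m≤n (subst (x * suc n <_) (+-suc S n) lo)) hi′))
  where
  open ≤-Reasoning
  hi′ : S + n < suc x * suc n
  hi′ = begin-strict
    S + n               <⟨ +-monoˡ-< n (≰⇒> x*N≰S) ⟩
    x * suc n + n       ≤⟨ +-monoʳ-≤ (x * suc n) (n≤1+n n) ⟩
    x * suc n + suc n   ≡⟨ +-comm (x * suc n) (suc n) ⟩
    suc x * suc n       ∎

⌊/⌋≤⌈/⌉ : ∀ S N → ⌊ S / N ⌋ ≤ ⌈ S / N ⌉
⌊/⌋≤⌈/⌉ S zero = z≤n
⌊/⌋≤⌈/⌉ S (suc n) = /-monoˡ-≤ (suc n) (m≤m+n S n)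

⌈/⌉≤1+⌊/⌋ : ∀ S N → ⌈ S / N ⌉ ≤ suc ⌊ S / N ⌋
⌈/⌉≤1+⌊/⌋ S zero = z≤n
⌈/⌉≤1+⌊/⌋ S (suc n) = begin
  (S + n) / suc n                    ≤⟨ /-monoˡ-≤ (suc n) (+-monoʳ-≤ S (n≤1+n n)) ⟩
  (S + suc n) / suc n                ≡⟨ m/n≡1+[m∸n]/n (m≤n+m (suc n) S) ⟩
  suc ((S + suc n ∸ suc n) / suc n)  ≡⟨ cong (λ t → suc (t / suc n)) (m+n∸n≡m S (suc n)) ⟩
  suc (S / suc n)                    ∎
  where open ≤-Reasoning

floorOrCeil-spread : ∀ {x y S N} → FloorOrCeil x S N → FloorOrCeil y S N → x ≤ suc y
floorOrCeil-spread {S = S} {N} fx fy =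
  ≤-trans (≤⌈/⌉ fx) (≤-trans (⌈/⌉≤1+⌊/⌋ S N) (s≤s (⌊/⌋≤ fy)))
  where
  ≤⌈/⌉ : ∀ {x} → FloorOrCeil x S N → x ≤ ⌈ S / N ⌉
  ≤⌈/⌉ (inj₁ refl) = ⌊/⌋≤⌈/⌉ S N
  ≤⌈/⌉ (inj₂ refl) = ≤-refl
  ⌊/⌋≤ : ∀ {y} → FloorOrCeil y S N → ⌊ S / N ⌋ ≤ y
  ⌊/⌋≤ (inj₁ refl) = ≤-refl
  ⌊/⌋≤ (inj₂ refl) = ⌊/⌋≤⌈/⌉ S N

floorOrCeil-exact : ∀ m n → FloorOrCeil m (m * suc n) (suc n)
floorOrCeil-exact m n = inj₁ (sym (m*n/n≡m m (suc n)))

floorOrCeil-pred : ∀ {m n} → m ≤ suc n → FloorOrCeil (pred m) (m * n) (suc n)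
floorOrCeil-pred {zero} _ = inj₁ refl
floorOrCeil-pred {suc x} {n} (s≤s x≤n) = floorOrCeil-intro lo (*-monoʳ-< (suc x) (n<1+n n))
  where
  open ≤-Reasoning
  lo : x * suc n < suc x * n + suc n
  lo = begin-strict
    x * suc n          ≡⟨ *-suc x n ⟩
    x + x * n          ≤⟨ +-monoˡ-≤ (x * n) x≤n ⟩
    suc x * n          <⟨ m<m+n (suc x * n) z<s ⟩
    suc x * n + suc n  ∎

floorOrCeil-ceil : ∀ {m n} → m ≤ n → FloorOrCeil m (m * n) (suc n)
floorOrCeil-ceil {m} {n} m≤n = floorOrCeil-intro lo hi
  where
  open ≤-Reasoning
  lo : m * suc n < m * n + suc n
  lo = begin-strict
    m * suc n       ≡⟨ *-suc m n ⟩
    m + m * n       <⟨ +-monoˡ-< (m * n) (s≤s m≤n) ⟩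
    suc n + m * n   ≡⟨ +-comm (suc n) (m * n) ⟩
    m * n + suc n   ∎
  hi : m * n < suc m * suc n
  hi = begin-strict
    m * n           ≤⟨ *-monoʳ-≤ m (n≤1+n n) ⟩
    m * suc n       <⟨ m<n+m (m * suc n) z<s ⟩
    suc m * suc n   ∎

≡⇒≤1+ : ∀ {x y} → x ≡ y → x ≤ suc y
≡⇒≤1+ refl = n≤1+n _

spread-of-deficits : ∀ {x a y b m} → x + a ≡ m → y + b ≡ m → b ≤ 1 → x ≤ suc y
spread-of-deficits {x} {a} {y} {b} {m} x+a≡m y+b≡m b≤1 = begin
  x       ≤⟨ m≤m+n x a ⟩
  x + a   ≡⟨ trans x+a≡m (sym y+b≡m) ⟩
  y + b   ≤⟨ +-monoʳ-≤ y b≤1 ⟩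
  y + 1   ≡⟨ +-comm y 1 ⟩
  suc y   ∎
  where open ≤-Reasoning

*-monoʳ-≤-01 : ∀ w {a b} → w ≤ 1 → (w ≡ 1 → a ≤ b) → w * a ≤ w * b
*-monoʳ-≤-01 zero _ _ = z≤n
*-monoʳ-≤-01 (suc zero) _ a≤b = *-monoʳ-≤ 1 (a≤b refl)
*-monoʳ-≤-01 (suc (suc _)) (s≤s ()) _

module _ {a b : ℕ} where

  floorOrCeil-mean : (w v : Fin a → Fin b → ℕ) → (∀ i j → w i j ≤ 1) →
                     ∀ p q → w p q ≡ 1 →
                     (∀ i j → w i j ≡ 1 → v i j ≤ suc (v p q) × v p q ≤ suc (v i j)) →
                     FloorOrCeil (v p q) (∑∑ λ i j → w i j * v i j) (∑∑ w)
  floorOrCeil-mean w v w≤1 p q wpq≡1 near = floorOrCeil-intro lo hi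
    where
    x S N : ℕ
    x = v p q
    S = ∑∑ λ i j → w i j * v i j
    N = ∑∑ w
    at-p : ∀ {c d} → c < d → w p q * c < w p q * d
    at-p c<d = subst (λ t → t * _ < t * _) (sym wpq≡1) (*-monoʳ-< 1 c<d)
    lo : x * N < S + N
    lo = begin-strict
      x * N                           ≡⟨ *-comm x N ⟩
      N * x                           ≡⟨ ∑∑-*ʳ x w ⟨
      ∑∑ (λ i j → w i j * x)          <⟨ ∑∑-mono-< (λ i j → *-monoʳ-≤-01 (w i j) (w≤1 i j) (proj₂ ∘ near i j))
                                                    p q (at-p (s≤s ≤-refl)) ⟩
      ∑∑ (λ i j → w i j * suc (v i j)) ≡⟨ ∑-cong (λ i → ∑-cong λ j → trans (*-suc (w i j) _) (+-comm (w i j) _)) ⟩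
      ∑∑ (λ i j → w i j * v i j + w i j) ≡⟨ ∑∑-distrib-+ _ w ⟩
      S + N                           ∎
      where open ≤-Reasoning
    hi : S < suc x * N
    hi = begin-strict
      S                               <⟨ ∑∑-mono-< (λ i j → *-monoʳ-≤-01 (w i j) (w≤1 i j) (proj₁ ∘ near i j))
                                                    p q (at-p ≤-refl) ⟩
      ∑∑ (λ i j → w i j * suc x)      ≡⟨ ∑∑-*ʳ (suc x) w ⟩
      N * suc x                       ≡⟨ *-comm N (suc x) ⟩
      suc x * N                       ∎
      where open ≤-Reasoning

  floorOrCeil-grid : (v : Fin a → Fin b → ℕ) → (∀ i j i′ j′ → v i j ≤ suc (v i′ j′)) →
                     ∀ i j → FloorOrCeil (v i j) (∑∑ v) (a * b)
  floorOrCeil-grid v spread i j =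
    subst₂ (FloorOrCeil (v i j)) (∑-cong {a} λ i → ∑-cong {b} λ j → *-identityˡ (v i j))
                                 (trans (∑-cong {a} λ _ → ∑-const-1 {b}) (∑-const {a} b))
           (floorOrCeil-mean (λ _ _ → 1) v (λ _ _ → s≤s z≤n) i j refl
                             λ i′ j′ _ → spread i′ j′ i j , spread i j i′ j′)

∑∑-ordered-pairs : ∀ c → ∑∑ {c} {c} (λ j j′ → 𝟙 (toℕ j <?ⁿ toℕ j′)) ≡ c C 2
∑∑-ordered-pairs zero = refl
∑∑-ordered-pairs (suc c) = begin
    (𝟙 (0 <?ⁿ 0) + ∑ {c} (λ j′ → 𝟙 (0 <?ⁿ suc (toℕ j′))))
      + ∑ {c} (λ j → 𝟙 (suc (toℕ j) <?ⁿ 0) + ∑ {c} (λ j′ → 𝟙 (suc (toℕ j) <?ⁿ suc (toℕ j′))))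
  ≡⟨ cong₂ _+_ (cong₂ _+_ (𝟙-no (0 <?ⁿ 0) λ ())
                          (trans (∑-cong {c} λ j′ → 𝟙-yes (0 <?ⁿ suc (toℕ j′)) (s≤s z≤n)) (∑-const-1 {c})))
               (∑-cong {c} λ j → cong₂ _+_ (𝟙-no (suc (toℕ j) <?ⁿ 0) λ ())
                                       (∑-cong {c} λ j′ → 𝟙-cong (suc (toℕ j) <?ⁿ suc (toℕ j′)) (toℕ j <?ⁿ toℕ j′)
                                                                 ≤-pred s≤s)) ⟩
    c + ∑∑ {c} {c} (λ j j′ → 𝟙 (toℕ j <?ⁿ toℕ j′))
  ≡⟨ cong₂ _+_ (sym (nC1≡n c)) (∑∑-ordered-pairs c) ⟩
    c C 1 + c C 2
  ≡⟨ nCk+nC[k+1]≡[n+1]C[k+1] c 1 ⟩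
    suc c C 2
  ∎
  where open ≡-Reasoning

∑-pairs : ∀ {c} → (Fin c → Fin c → ℕ) → ℕ
∑-pairs v = ∑∑ λ j j′ → 𝟙 (toℕ j <?ⁿ toℕ j′) * v j j′

floorOrCeil-ordered : ∀ {c} (v : Fin c → Fin c → ℕ) → (∀ i j i′ j′ → i ≢ j → i′ ≢ j′ → v i j ≤ suc (v i′ j′)) →
                      ∀ p q → toℕ p < toℕ q →
                      FloorOrCeil (v p q) (∑-pairs v) (c C 2)
floorOrCeil-ordered {c} v spread p q p<q = subst (FloorOrCeil (v p q) _) (∑∑-ordered-pairs c)
  (floorOrCeil-mean _ v (λ _ _ → 𝟙≤1 _) p q (𝟙-yes _ p<q) λ i j wᵢⱼ≡1 →
     let i≢j = λ { refl → <-irrefl refl (𝟙≡1⇒ _ wᵢⱼ≡1) } in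
     spread i j p q i≢j p≢q , spread p q i j p≢q i≢j)
  where p≢q = λ { refl → <-irrefl refl p<q }

floorOrCeil-pairs : ∀ {c} (v : Fin c → Fin c → ℕ) → (∀ j j′ → v j j′ ≡ v j′ j) →
                    (∀ i j i′ j′ → i ≢ j → i′ ≢ j′ → v i j ≤ suc (v i′ j′)) →
                    ∀ j j′ → j ≢ j′ →
                    FloorOrCeil (v j j′) (∑-pairs v) (c C 2)
floorOrCeil-pairs {c} v v-sym spread j j′ j≢j′ with <-cmp (toℕ j) (toℕ j′)
... | tri< j<j′ _ _ = floorOrCeil-ordered v spread j j′ j<j′
... | tri≈ _ j≡j′ _ = ⊥-elim (j≢j′ (Finₚ.toℕ-injective j≡j′))
... | tri> _ _ j′<j =
  subst (λ t → FloorOrCeil t (∑-pairs v) (c C 2)) (v-sym j′ j) (floorOrCeil-ordered v spread j′ j j′<j)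

module _ {r c v : ℕ} (X : Design r c v) where

  rr∩-sym : ∀ i i′ → rr∩ X i i′ ≡ rr∩ X i′ i
  rr∩-sym i i′ = ∑-cong λ s → 𝟙-×-dec-comm (inRow? X i s) (inRow? X i′ s)

  cc∩-sym : ∀ j j′ → cc∩ X j j′ ≡ cc∩ X j′ j
  cc∩-sym j j′ = ∑-cong λ s → 𝟙-×-dec-comm (inCol? X j s) (inCol? X j′ s)

  nearTripleArray-intro : Binary X → EquiOrNearEqui X →
                          (∀ i j i′ j′ → rc∩ X i j ≤ suc (rc∩ X i′ j′)) →
                          (∀ i₁ i₂ i₃ i₄ → i₁ ≢ i₂ → i₃ ≢ i₄ → rr∩ X i₁ i₂ ≤ suc (rr∩ X i₃ i₄)) →
                          (∀ j₁ j₂ j₃ j₄ → j₁ ≢ j₂ → j₃ ≢ j₄ → cc∩ X j₁ j₂ ≤ suc (cc∩ X j₃ j₄)) →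
                          IsNearTripleArray X
  nearTripleArray-intro binary replication rc-spread rr-spread cc-spread = record
    { binary = binary
    ; replication = replication
    ; rowCol = floorOrCeil-grid (rc∩ X) rc-spread
    ; rowRow = floorOrCeil-pairs (rr∩ X) rr∩-sym rr-spread
    ; colCol = floorOrCeil-pairs (cc∩ X) cc∩-sym cc-spread
    }

-- Hall's theorem

boolToℕ : Bool → ℕ
boolToℕ true = 1
boolToℕ false = 0

boolToℕ-isYes : ∀ {p} {P : Set p} (d : Dec P) → boolToℕ (isYes d) ≡ 𝟙 d
boolToℕ-isYes (yes _) = refl
boolToℕ-isYes (no _) = refl

boolToℕ-mono : ∀ {x y} → (T x → T y) → boolToℕ x ≤ boolToℕ y
boolToℕ-mono {false} _ = z≤n
boolToℕ-mono {true} {true} _ = ≤-refl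
boolToℕ-mono {true} {false} x⇒y = ⊥-elim (x⇒y _)

boolToℕ-T : ∀ {x} → T x → boolToℕ x ≡ 1
boolToℕ-T {true} _ = refl

boolToℕ-¬T : ∀ {x} → ¬ T x → boolToℕ x ≡ 0
boolToℕ-¬T {false} _ = refl
boolToℕ-¬T {true} ¬x = ⊥-elim (¬x _)

module _ {n : ℕ} where

  card : (Fin n → Bool) → ℕ
  card X = ∑ (boolToℕ ∘ X)

  _⊆_ : (Fin n → Bool) → (Fin n → Bool) → Set
  X ⊆ Y = ∀ i → T (X i) → T (Y i)

  _∪_ _∩_ : (Fin n → Bool) → (Fin n → Bool) → Fin n → Bool
  (X ∪ Y) i = X i ∨ Y i
  (X ∩ Y) i = X i ∧ Y i

  ⁅_⁆ : Fin n → Fin n → Bool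
  ⁅ x ⁆ i = isYes (x ≟ᶠ i)

  _-_ : (Fin n → Bool) → Fin n → Fin n → Bool
  (X - x) i = X i ∧ not (isYes (x ≟ᶠ i))

  card-mono : ∀ {X Y} → X ⊆ Y → card X ≤ card Y
  card-mono X⊆Y = ∑-mono-≤ λ i → boolToℕ-mono (X⊆Y i)

  card-zero : ∀ {X} → (∀ i → ¬ T (X i)) → card X ≡ 0
  card-zero X-empty = ∑-zero λ i → boolToℕ-¬T (X-empty i)

  card-⁅⁆ : ∀ x → card ⁅ x ⁆ ≡ 1
  card-⁅⁆ x = trans (∑-cong λ i → boolToℕ-isYes (x ≟ᶠ i)) (∑-δ-1 x)

  card-∪-∩ : ∀ X Y → card (X ∪ Y) + card (X ∩ Y) ≡ card X + card Y
  card-∪-∩ X Y = trans (sym (∑-distrib-+ {n} _ _)) (trans (∑-cong pointwise) (∑-distrib-+ {n} _ _))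
    where
    pointwise : ∀ i → boolToℕ (X i ∨ Y i) + boolToℕ (X i ∧ Y i) ≡ boolToℕ (X i) + boolToℕ (Y i)
    pointwise i with X i | Y i
    ... | true | true = refl
    ... | true | false = refl
    ... | false | true = refl
    ... | false | false = refl

  card-∪ : ∀ X Y → card (X ∪ Y) ≤ card X + card Y
  card-∪ X Y = subst (card (X ∪ Y) ≤_) (card-∪-∩ X Y) (m≤m+n _ _)

  card-- : ∀ X x → card X ≤ card (X - x) + 1
  card-- X x = begin
    card X                    ≤⟨ card-mono X⊆[X-x]∪⁅x⁆ ⟩
    card ((X - x) ∪ ⁅ x ⁆)    ≤⟨ card-∪ (X - x) ⁅ x ⁆ ⟩
    card (X - x) + card ⁅ x ⁆ ≡⟨ cong (card (X - x) +_) (card-⁅⁆ x) ⟩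
    card (X - x) + 1          ∎
    where
    open ≤-Reasoning
    X⊆[X-x]∪⁅x⁆ : X ⊆ ((X - x) ∪ ⁅ x ⁆)
    X⊆[X-x]∪⁅x⁆ i Xᵢ with X i | x ≟ᶠ i
    ... | true | yes _ = _
    ... | true | no _ = _

Graph : ℕ → ℕ → Set
Graph a b = Fin a → Fin b → Bool

module _ {a b : ℕ} where

  Γ : Graph a b → (Fin a → Bool) → Fin b → Bool
  Γ G X s = isYes (any? λ j → T? (X j) ×-dec T? (G j s))

  Γ-intro : ∀ {G X j s} → T (X j) → T (G j s) → T (Γ G X s)
  Γ-intro {j = j} Xⱼ Gⱼₛ = fromWitness (j , Xⱼ , Gⱼₛ)

  Γ-elim : ∀ {G X s} → T (Γ G X s) → ∃ λ j → T (X j) × T (G j s)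
  Γ-elim = toWitness

  Γ-mono : ∀ {G X Y} → X ⊆ Y → Γ G X ⊆ Γ G Y
  Γ-mono {G} {X} X⊆Y s Γₛ with j , Xⱼ , Gⱼₛ ← Γ-elim {G} {X} Γₛ = Γ-intro {G} (X⊆Y j Xⱼ) Gⱼₛ

  HallCondition : Graph a b → Set
  HallCondition G = ∀ X → card X ≤ card (Γ G X)

  Deficient : Graph a b → (Fin a → Bool) → Set
  Deficient G X = card (Γ G X) < card X

  hall? : ∀ G → HallCondition G ⊎ ∃ (Deficient G)
  hall? G with anySubset? (λ X → card (Γ G (lookup X)) <?ⁿ card (lookup X))
  ... | yes (X , deficient) = inj₂ (lookup X , deficient)
  ... | no ¬deficient = inj₁ λ X → begin
    card X                          ≤⟨ card-mono (X⊆ X) ⟩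
    card (lookup (tabulate X))      ≤⟨ ≮⇒≥ (λ deficient → ¬deficient (tabulate X , deficient)) ⟩
    card (Γ G (lookup (tabulate X))) ≤⟨ card-mono (Γ-mono (⊆X X)) ⟩
    card (Γ G X)                    ∎
    where
    open ≤-Reasoning
    X⊆ : ∀ X → X ⊆ lookup (tabulate X)
    X⊆ X i = subst T (sym (lookup∘tabulate X i))
    ⊆X : ∀ X → lookup (tabulate X) ⊆ X
    ⊆X X i = subst T (lookup∘tabulate X i)

  Matching : Graph a b → Set
  Matching G = Σ (Fin a → Fin b) λ f → Injective _≡_ _≡_ f × ∀ j → T (G j (f j))

  edges : Graph a b → ℕ
  edges G = ∑∑ λ j s → boolToℕ (G j s)

  _∖_ : Graph a b → Fin a × Fin b → Graph a b
  (G ∖ (x , y)) j s = G j s ∧ not (isYes ((j ≟ᶠ x) ×-dec (s ≟ᶠ y)))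

  ∖-⊆ : ∀ {G e j s} → T ((G ∖ e) j s) → T (G j s)
  ∖-⊆ = proj₁ ∘ Equivalence.to T-∧

  ∖-keeps : ∀ {G x y j s} → T (G j s) → ¬ (j ≡ x × s ≡ y) → T ((G ∖ (x , y)) j s)
  ∖-keeps Gⱼₛ ≢e = Equivalence.from T-∧ (Gⱼₛ , fromWitnessFalse ≢e)

  edges-∖ : ∀ {G x y} → T (G x y) → edges (G ∖ (x , y)) < edges G
  edges-∖ {G} {x} {y} Gₓᵧ = ∑∑-mono-< (λ j s → boolToℕ-mono (∖-⊆ {G} {x , y} {j} {s})) x y (begin-strict
    boolToℕ ((G ∖ (x , y)) x y) ≡⟨ boolToℕ-¬T (λ t → toWitnessFalse (proj₂ (Equivalence.to (T-∧ {G x y}) t))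
                                                                     (refl , refl)) ⟩
    0                           <⟨ s≤s z≤n ⟩
    1                           ≡⟨ boolToℕ-T Gₓᵧ ⟨
    boolToℕ (G x y)             ∎)
    where open ≤-Reasoning

  Matching-∖ : ∀ {G e} → Matching (G ∖ e) → Matching G
  Matching-∖ {G} {e} (f , f-inj , edge) = f , f-inj , λ j → ∖-⊆ {G} {e} (edge j)

  TwoNeighbours : Graph a b → Set
  TwoNeighbours G = ∃ λ x → ∃₂ λ y y′ → y ≢ y′ × T (G x y) × T (G x y′)

  twoNeighbours? : ∀ G → Dec (TwoNeighbours G)
  twoNeighbours? G = any? λ x → any? λ y → any? λ y′ → ¬? (y ≟ᶠ y′) ×-dec T? (G x y) ×-dec T? (G x y′)

  hall∧¬TwoNeighbours⇒matching : ∀ {G} → HallCondition G → ¬ TwoNeighbours G → Matching G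
  hall∧¬TwoNeighbours⇒matching {G} hallG ¬two = f , f-inj , f-edge
    where
    neighbour : ∀ j → ∃ λ s → T (G j s)
    neighbour j with any? (λ s → T? (G j s))
    ... | yes found = found
    ... | no none = ⊥-elim (1+n≰n (begin
      1                  ≡⟨ card-⁅⁆ j ⟨
      card ⁅ j ⁆         ≤⟨ hallG ⁅ j ⁆ ⟩
      card (Γ G ⁅ j ⁆)   ≡⟨ card-zero (λ s Γₛ → isolated s (Γ-elim {G} Γₛ)) ⟩
      0                  ∎))
      where
      open ≤-Reasoning
      isolated : ∀ s → ¬ ∃ λ j′ → T (⁅ j ⁆ j′) × T (G j′ s)
      isolated s (j′ , j≡j′ , Gⱼ′ₛ) = none (s , subst (λ i → T (G i s)) (sym (toWitness j≡j′)) Gⱼ′ₛ)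
    f : Fin a → Fin b
    f = proj₁ ∘ neighbour
    f-edge : ∀ j → T (G j (f j))
    f-edge = proj₂ ∘ neighbour
    unique : ∀ {j s} → T (G j s) → f j ≡ s
    unique {j} {s} Gⱼₛ with f j ≟ᶠ s
    ... | yes fⱼ≡s = fⱼ≡s
    ... | no fⱼ≢s = ⊥-elim (¬two (j , f j , s , fⱼ≢s , f-edge j , Gⱼₛ))
    f-inj : Injective _≡_ _≡_ f
    f-inj {j} {j′} fⱼ≡fⱼ′ with j ≟ᶠ j′
    ... | yes j≡j′ = j≡j′
    ... | no j≢j′ = ⊥-elim (1+n≰n (begin
      2                            ≡⟨ cong₂ _+_ (card-⁅⁆ j) (card-⁅⁆ j′) ⟨
      card ⁅ j ⁆ + card ⁅ j′ ⁆       ≡⟨ card-∪-∩ ⁅ j ⁆ ⁅ j′ ⁆ ⟨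
      card X + card (⁅ j ⁆ ∩ ⁅ j′ ⁆) ≡⟨ cong (card X +_) (card-zero disjoint) ⟩
      card X + 0                   ≡⟨ +-identityʳ (card X) ⟩
      card X                       ≤⟨ hallG X ⟩
      card (Γ G X)                 ≤⟨ card-mono Γ⊆⁅fⱼ⁆ ⟩
      card ⁅ f j ⁆                 ≡⟨ card-⁅⁆ (f j) ⟩
      1                            ∎))
      where
      open ≤-Reasoning
      X : Fin a → Bool
      X = ⁅ j ⁆ ∪ ⁅ j′ ⁆
      disjoint : ∀ i → ¬ T ((⁅ j ⁆ ∩ ⁅ j′ ⁆) i)
      disjoint i t with Equivalence.to (T-∧ {⁅ j ⁆ i}) t
      ... | j≡i , j′≡i = j≢j′ (trans (toWitness j≡i) (sym (toWitness j′≡i)))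
      Γ⊆⁅fⱼ⁆ : Γ G X ⊆ ⁅ f j ⁆
      Γ⊆⁅fⱼ⁆ s Γₛ with i , Xᵢ , Gᵢₛ ← Γ-elim {G} Γₛ with Equivalence.to (T-∨ {⁅ j ⁆ i}) Xᵢ
      ... | inj₁ j≡i = fromWitness (trans (cong f (toWitness j≡i)) (unique Gᵢₛ))
      ... | inj₂ j′≡i = fromWitness (trans fⱼ≡fⱼ′ (trans (cong f (toWitness j′≡i)) (unique Gᵢₛ)))

  module _ {G : Graph a b} (hallG : HallCondition G) {x : Fin a} where

    deficient-∖⇒∈ : ∀ {y X} → Deficient (G ∖ (x , y)) X → T (X x)
    deficient-∖⇒∈ {y} {X} deficient with T? (X x)
    ... | yes Xₓ = Xₓ
    ... | no ¬Xₓ = ⊥-elim (<-irrefl refl (≤-<-trans (≤-trans (hallG X) (card-mono Γ⊆)) deficient))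
      where
      Γ⊆ : Γ G X ⊆ Γ (G ∖ (x , y)) X
      Γ⊆ s Γₛ with j , Xⱼ , Gⱼₛ ← Γ-elim {G} Γₛ =
        Γ-intro {G ∖ (x , y)} Xⱼ (∖-keeps {G} Gⱼₛ λ (j≡x , _) → ¬Xₓ (subst (T ∘ X) j≡x Xⱼ))

    -- Rado's argument: Hall's condition for X₁ ∪ X₂ and (X₁ ∩ X₂) - x contradicts the deficiency of X₁ and X₂.
    ¬deficient-∖-both : ∀ {y₁ y₂ X₁ X₂} → y₁ ≢ y₂ →
                       Deficient (G ∖ (x , y₁)) X₁ → Deficient (G ∖ (x , y₂)) X₂ → ⊥
    ¬deficient-∖-both {y₁} {y₂} {X₁} {X₂} y₁≢y₂ deficient₁ deficient₂ = 1+n≰n (begin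
      suc (card X₁ + card X₂)                            ≡⟨ cong suc (card-∪-∩ X₁ X₂) ⟨
      suc (card (X₁ ∪ X₂) + card (X₁ ∩ X₂))              ≤⟨ s≤s (+-monoʳ-≤ (card (X₁ ∪ X₂)) (card-- (X₁ ∩ X₂) x)) ⟩
      suc (card (X₁ ∪ X₂) + (card I + 1))                ≤⟨ s≤s (+-mono-≤ (hallG (X₁ ∪ X₂)) (+-monoˡ-≤ 1 (hallG I))) ⟩
      suc (card (Γ G (X₁ ∪ X₂)) + (card (Γ G I) + 1))    ≤⟨ s≤s (+-mono-≤ (card-mono Γ∪) (+-monoˡ-≤ 1 (card-mono Γ∩))) ⟩
      suc (card (N₁ ∪ N₂) + (card (N₁ ∩ N₂) + 1))        ≡⟨ cong suc (sym (+-assoc (card (N₁ ∪ N₂)) _ 1)) ⟩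
      suc (card (N₁ ∪ N₂) + card (N₁ ∩ N₂) + 1)          ≡⟨ cong (λ t → suc (t + 1)) (card-∪-∩ N₁ N₂) ⟩
      suc (card N₁ + card N₂ + 1)                        ≡⟨ cong suc (+-comm _ 1) ⟩
      suc (suc (card N₁ + card N₂))                      ≡⟨ cong suc (+-suc (card N₁) (card N₂)) ⟨
      suc (card N₁) + suc (card N₂)                      ≤⟨ +-mono-≤ deficient₁ deficient₂ ⟩
      card X₁ + card X₂                                  ∎)
      where
      open ≤-Reasoning
      N₁ N₂ : Fin b → Bool
      N₁ = Γ (G ∖ (x , y₁)) X₁
      N₂ = Γ (G ∖ (x , y₂)) X₂
      I : Fin a → Bool
      I = (X₁ ∩ X₂) - x
      crossing : ∀ {y y′ X X′ j s} → y ≢ y′ → T (X′ x) → T (X j) → T (G j s) →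
                 T (Γ (G ∖ (x , y)) X s) ⊎ T (Γ (G ∖ (x , y′)) X′ s)
      crossing {y} {y′} {X} {X′} {j} {s} y≢y′ X′ₓ Xⱼ Gⱼₛ with (j ≟ᶠ x) ×-dec (s ≟ᶠ y)
      ... | yes (refl , refl) = inj₂ (Γ-intro {G ∖ (x , y′)} X′ₓ (∖-keeps {G} Gⱼₛ (y≢y′ ∘ proj₂)))
      ... | no ≢xy = inj₁ (Γ-intro {G ∖ (x , y)} Xⱼ (∖-keeps {G} Gⱼₛ ≢xy))
      Γ∪ : Γ G (X₁ ∪ X₂) ⊆ (N₁ ∪ N₂)
      Γ∪ s Γₛ with j , Xⱼ , Gⱼₛ ← Γ-elim {G} Γₛ =
        Equivalence.from T-∨ (case (Equivalence.to (T-∨ {X₁ j}) Xⱼ))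
        where
        case : T (X₁ j) ⊎ T (X₂ j) → T (N₁ s) ⊎ T (N₂ s)
        case (inj₁ X₁ⱼ) = crossing y₁≢y₂ (deficient-∖⇒∈ deficient₂) X₁ⱼ Gⱼₛ
        case (inj₂ X₂ⱼ) = swap (crossing (y₁≢y₂ ∘ sym) (deficient-∖⇒∈ deficient₁) X₂ⱼ Gⱼₛ)
      Γ∩ : Γ G I ⊆ (N₁ ∩ N₂)
      Γ∩ s Γₛ with j , Iⱼ , Gⱼₛ ← Γ-elim {G} Γₛ with Equivalence.to (T-∧ {(X₁ ∩ X₂) j}) Iⱼ
      ... | X₁₂ⱼ , x≢j with Equivalence.to (T-∧ {X₁ j}) X₁₂ⱼ
      ... | X₁ⱼ , X₂ⱼ = Equivalence.from T-∧
            ( Γ-intro {G ∖ (x , y₁)} X₁ⱼ (∖-keeps {G} Gⱼₛ j≢x)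
            , Γ-intro {G ∖ (x , y₂)} X₂ⱼ (∖-keeps {G} Gⱼₛ j≢x))
        where
        j≢x : ∀ {y} → ¬ (j ≡ x × s ≡ y)
        j≢x (j≡x , _) = toWitnessFalse x≢j (sym j≡x)

  hall-theorem : ∀ G → HallCondition G → Matching G
  hall-theorem G = go G (<-wellFounded (edges G))
    where
    go : ∀ G → Acc _<_ (edges G) → HallCondition G → Matching G
    go G (acc smaller) hallG with twoNeighbours? G
    ... | no ¬two = hall∧¬TwoNeighbours⇒matching hallG ¬two
    ... | yes (x , y₁ , y₂ , y₁≢y₂ , Gxy₁ , Gxy₂) with hall? (G ∖ (x , y₁)) | hall? (G ∖ (x , y₂))
    ...   | inj₁ hall₁ | _ = Matching-∖ {G} (go _ (smaller (edges-∖ {G} Gxy₁)) hall₁)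
    ...   | inj₂ _ | inj₁ hall₂ = Matching-∖ {G} (go _ (smaller (edges-∖ {G} Gxy₂)) hall₂)
    ...   | inj₂ (X₁ , deficient₁) | inj₂ (X₂ , deficient₂) =
            ⊥-elim (¬deficient-∖-both hallG y₁≢y₂ deficient₁ deficient₂)

  degree-bounded⇒hall : ∀ G d .{{_ : NonZero d}} →
                        (∀ j → d ≤ ∑ (λ s → boolToℕ (G j s))) →
                        (∀ s → ∑ (λ j → boolToℕ (G j s)) ≤ d) → HallCondition G
  degree-bounded⇒hall G d left-degree right-degree X = *-cancelʳ-≤ (card X) (card (Γ G X)) d (begin
    card X * d
      ≡⟨ ∑-*ʳ d (boolToℕ ∘ X) ⟨
    ∑ (λ j → boolToℕ (X j) * d)
      ≤⟨ ∑-mono-≤ (λ j → *-monoʳ-≤ (boolToℕ (X j)) (left-degree j)) ⟩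
    ∑ (λ j → boolToℕ (X j) * ∑ (λ s → boolToℕ (G j s)))
      ≡⟨ ∑-cong (λ j → ∑-*ˡ (boolToℕ (X j)) (boolToℕ ∘ G j)) ⟨
    ∑ (λ j → ∑ (λ s → boolToℕ (X j) * boolToℕ (G j s)))
      ≡⟨ ∑-comm (λ j s → boolToℕ (X j) * boolToℕ (G j s)) ⟩
    ∑ (λ s → ∑ (λ j → boolToℕ (X j) * boolToℕ (G j s)))
      ≤⟨ ∑-mono-≤ (λ s → ∑-mono-≤ (λ j → into-Γ j s)) ⟩
    ∑ (λ s → ∑ (λ j → boolToℕ (Γ G X s) * boolToℕ (G j s)))
      ≡⟨ ∑-cong (λ s → ∑-*ˡ (boolToℕ (Γ G X s)) (λ j → boolToℕ (G j s))) ⟩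
    ∑ (λ s → boolToℕ (Γ G X s) * ∑ (λ j → boolToℕ (G j s)))
      ≤⟨ ∑-mono-≤ (λ s → *-monoʳ-≤ (boolToℕ (Γ G X s)) (right-degree s)) ⟩
    ∑ (λ s → boolToℕ (Γ G X s) * d)
      ≡⟨ ∑-*ʳ d (boolToℕ ∘ Γ G X) ⟩
    card (Γ G X) * d
      ∎)
    where
    open ≤-Reasoning
    into-Γ : ∀ j s → boolToℕ (X j) * boolToℕ (G j s) ≤ boolToℕ (Γ G X s) * boolToℕ (G j s)
    into-Γ j s with X j in Xⱼ | G j s in Gⱼₛ
    ... | false | _ = z≤n
    ... | true | false = z≤n
    ... | true | true =
      *-monoˡ-≤ 1 (≤-reflexive (sym (boolToℕ-T (Γ-intro {G} (Equivalence.from T-≡ Xⱼ) (Equivalence.from T-≡ Gⱼₛ)))))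

-- Completing a Latin rectangle

Disjoint : ∀ {k t} → Design k n n → Design t n n → Set
Disjoint A B = ∀ i i′ j → A i j ≢ B i′ j

module Completion {k : ℕ} (A : Design k n n) (A-bin : Binary A) where

  open LatinRectangle

  extend : ∀ {t} (B : Design t n n) → Binary B → Disjoint A B → k + t < n →
           Σ (Design (suc t) n n) λ B′ → Binary B′ × Disjoint A B′
  extend {t} B B-bin A∦B k+t<n = σ ∷ B , (σ-rows , σ-columns) , σ-disjoint
    where
    G : Graph n n
    G j s = isYes (¬? (inCol? A j s) ×-dec ¬? (inCol? B j s))
    taken : Fin n → Fin n → ℕ
    taken j s = 𝟙 (inCol? A j s) + 𝟙 (inCol? B j s)
    partition : ∀ j s → boolToℕ (G j s) + taken j s ≡ 1
    partition j s with inCol? A j s | inCol? B j s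
    ... | yes (i , Aᵢⱼ≡s) | yes (i′ , Bᵢ′ⱼ≡s) = ⊥-elim (A∦B i i′ j (trans Aᵢⱼ≡s (sym Bᵢ′ⱼ≡s)))
    ... | yes _ | no _ = refl
    ... | no _ | yes _ = refl
    ... | no _ | no _ = refl
    d : ℕ
    d = n ∸ (k + t)
    residual : ∀ {x c} → x + c ≡ n → c ≡ k + t → x ≡ d
    residual {x} x+c≡n c≡k+t =
      trans (sym (m+n∸n≡m x (k + t))) (cong (_∸ (k + t)) (trans (cong (x +_) (sym c≡k+t)) x+c≡n))
    left-degree : ∀ j → ∑ (λ s → boolToℕ (G j s)) ≡ d
    left-degree j = residual (∑-complement _ (taken j) (partition j))
      (trans (∑-distrib-+ {n} _ _) (cong₂ _+_ (column-size A A-bin j) (column-size B B-bin j)))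
    right-degree : ∀ s → ∑ (λ j → boolToℕ (G j s)) ≡ d
    right-degree s = residual (∑-complement _ (λ j → taken j s) (λ j → partition j s))
      (trans (∑-distrib-+ {n} _ _) (cong₂ _+_ (columns-containing A A-bin s) (columns-containing B B-bin s)))
    matching : Matching G
    matching = hall-theorem G (degree-bounded⇒hall G d {{>-nonZero (m<n⇒0<n∸m k+t<n)}}
                                 (≤-reflexive ∘ sym ∘ left-degree) (≤-reflexive ∘ right-degree))
    σ : Fin n → Fin n
    σ = proj₁ matching
    σ-free : ∀ j → ¬ (∃ λ i → A i j ≡ σ j) × ¬ (∃ λ i → B i j ≡ σ j)
    σ-free j = toWitness (proj₂ (proj₂ matching) j)
    σ-rows : ∀ i → Injective _≡_ _≡_ (λ j → (σ ∷ B) i j)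
    σ-rows Fin.zero = proj₁ (proj₂ matching)
    σ-rows (Fin.suc i) = proj₁ B-bin i
    σ-columns : ∀ j → Injective _≡_ _≡_ (λ i → (σ ∷ B) i j)
    σ-columns j {Fin.zero} {Fin.zero} _ = refl
    σ-columns j {Fin.zero} {Fin.suc i′} σⱼ≡Bᵢ′ⱼ = ⊥-elim (proj₂ (σ-free j) (i′ , sym σⱼ≡Bᵢ′ⱼ))
    σ-columns j {Fin.suc i} {Fin.zero} Bᵢⱼ≡σⱼ = ⊥-elim (proj₂ (σ-free j) (i , Bᵢⱼ≡σⱼ))
    σ-columns j {Fin.suc i} {Fin.suc i′} Bᵢⱼ≡Bᵢ′ⱼ = cong Fin.suc (proj₂ B-bin j Bᵢⱼ≡Bᵢ′ⱼ)
    σ-disjoint : Disjoint A (σ ∷ B)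
    σ-disjoint i Fin.zero j Aᵢⱼ≡σⱼ = proj₁ (σ-free j) (i , Aᵢⱼ≡σⱼ)
    σ-disjoint i (Fin.suc i′) j = A∦B i i′ j

  complete : ∀ t → k + t ≤ n → Σ (Design t n n) λ B → Binary B × Disjoint A B
  complete zero _ = (λ ()) , ((λ ()) , λ { _ {()} }) , λ _ ()
  complete (suc t) k+t<n with B , B-bin , A∦B ← complete t (≤-trans (+-monoʳ-≤ k (n≤1+n t)) k+t<n) =
    extend B B-bin A∦B (subst (_≤ n) (+-suc k t) k+t<n)

-- The complementary designs

module Complement {k m n′ : ℕ} (A : Design k (suc n′) (suc n′)) (A-nta : IsNearTripleArray A)
                  (B : Design m (suc n′) (suc n′)) (B-bin : Binary B) (A∦B : Disjoint A B)
                  (k+m≡n : k + m ≡ suc n′) where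

  open IsNearTripleArray A-nta using () renaming (binary to A-bin; colCol to A-colCol)
  open LatinRectangle

  complementary : ∀ j s → 𝟙 (inCol? A j s) + 𝟙 (inCol? B j s) ≡ 1
  complementary j = ∑≡n⇒≡1 _ at-most-one
    (trans (∑-distrib-+ (λ s → 𝟙 (inCol? A j s)) (λ s → 𝟙 (inCol? B j s)))
           (trans (cong₂ _+_ (column-size A A-bin j) (column-size B B-bin j)) k+m≡n))
    where
    at-most-one : ∀ s → 𝟙 (inCol? A j s) + 𝟙 (inCol? B j s) ≤ 1
    at-most-one s with inCol? A j s | inCol? B j s
    ... | yes (i , Aᵢⱼ≡s) | yes (i′ , Bᵢ′ⱼ≡s) = ⊥-elim (A∦B i i′ j (trans Aᵢⱼ≡s (sym Bᵢ′ⱼ≡s)))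
    ... | yes _ | no _ = ≤-refl
    ... | no _ | yes _ = ≤-refl
    ... | no _ | no _ = z≤n

  cc∩-complement : ∀ j j′ → cc∩ B j j′ + (k + k) ≡ suc n′ + cc∩ A j j′
  cc∩-complement j j′ = begin
    cc∩ B j j′ + (k + k)
      ≡⟨ cong₂ _+_ (∑-cong λ s → 𝟙-×-dec (inCol? B j s) (inCol? B j′ s))
                   (sym (cong₂ _+_ (column-size A A-bin j) (column-size A A-bin j′))) ⟩
    ∑ (λ s → 𝟙 (inCol? B j s) * 𝟙 (inCol? B j′ s)) + (∑ (λ s → 𝟙 (inCol? A j s)) + ∑ (λ s → 𝟙 (inCol? A j′ s)))
      ≡⟨ ∑-complement-∩ (λ s → 𝟙 (inCol? A j s)) (λ s → 𝟙 (inCol? B j s))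
                        (λ s → 𝟙 (inCol? A j′ s)) (λ s → 𝟙 (inCol? B j′ s)) (complementary j) (complementary j′) ⟩
    suc n′ + ∑ (λ s → 𝟙 (inCol? A j s) * 𝟙 (inCol? A j′ s))
      ≡⟨ cong (suc n′ +_) (∑-cong λ s → sym (𝟙-×-dec (inCol? A j s) (inCol? A j′ s))) ⟩
    suc n′ + cc∩ A j j′
      ∎
    where open ≡-Reasoning

  B-cc-spread : ∀ j₁ j₂ j₃ j₄ → j₁ ≢ j₂ → j₃ ≢ j₄ → cc∩ B j₁ j₂ ≤ suc (cc∩ B j₃ j₄)
  B-cc-spread j₁ j₂ j₃ j₄ j₁≢j₂ j₃≢j₄ = +-cancelʳ-≤ (k + k) _ _ (begin
    cc∩ B j₁ j₂ + (k + k)         ≡⟨ cc∩-complement j₁ j₂ ⟩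
    suc n′ + cc∩ A j₁ j₂          ≤⟨ +-monoʳ-≤ (suc n′) (floorOrCeil-spread {S = Σcc A} {N = suc n′ C 2}
                                                          (A-colCol j₁ j₂ j₁≢j₂) (A-colCol j₃ j₄ j₃≢j₄)) ⟩
    suc n′ + suc (cc∩ A j₃ j₄)    ≡⟨ +-suc (suc n′) _ ⟩
    suc (suc n′ + cc∩ A j₃ j₄)    ≡⟨ cong suc (cc∩-complement j₃ j₄) ⟨
    suc (cc∩ B j₃ j₄ + (k + k))   ∎)
    where open ≤-Reasoning

  B-rc∩ : ∀ i j → rc∩ B i j ≡ m
  B-rc∩ i j = trans (∑-cong λ s → trans (𝟙-×-dec (inRow? B i s) (inCol? B j s))
                                        (trans (cong (_* 𝟙 (inCol? B j s)) (𝟙-inRow B B-bin i s)) (+-identityʳ _)))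
                    (column-size B B-bin j)

  B-rr∩ : ∀ i i′ → rr∩ B i i′ ≡ suc n′
  B-rr∩ i i′ = trans (∑-cong λ s → trans (𝟙-×-dec (inRow? B i s) (inRow? B i′ s))
                                         (cong₂ _*_ (𝟙-inRow B B-bin i s) (𝟙-inRow B B-bin i′ s)))
                     ∑-const-1

  B-nta : IsNearTripleArray B
  B-nta = nearTripleArray-intro B B-bin
    (λ s → subst (λ x → FloorOrCeil x (m * suc n′) (suc n′)) (sym (occ-latin B B-bin s)) (floorOrCeil-exact m n′))
    (λ i j i′ j′ → ≡⇒≤1+ (trans (B-rc∩ i j) (sym (B-rc∩ i′ j′))))
    (λ i₁ i₂ i₃ i₄ _ _ → ≡⇒≤1+ (trans (B-rr∩ i₁ i₂) (sym (B-rr∩ i₃ i₄))))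
    B-cc-spread

  D : Design m n′ (suc n′)
  D i j = B i (Fin.suc j)

  D-bin : Binary D
  D-bin = (λ i Dᵢⱼ≡Dᵢⱼ′ → Finₚ.suc-injective (proj₁ B-bin i Dᵢⱼ≡Dᵢⱼ′)) , (λ j → proj₂ B-bin (Fin.suc j))

  D-row-split : ∀ i s → 𝟙 (inRow? D i s) + 𝟙 (B i Fin.zero ≟ᶠ s) ≡ 1
  D-row-split i s = trans (+-comm (𝟙 (inRow? D i s)) _)
    (trans (cong (𝟙 (B i Fin.zero ≟ᶠ s) +_) (sym (count-injective (D i) (proj₁ D-bin i) s)))
           (count-row B B-bin i s))

  D-occ : ∀ s → occ D s + 𝟙 (inCol? B Fin.zero s) ≡ m
  D-occ s = begin
    occ D s + 𝟙 (inCol? B Fin.zero s)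
      ≡⟨ +-comm (occ D s) _ ⟩
    𝟙 (inCol? B Fin.zero s) + occ D s
      ≡⟨ cong (_+ occ D s) (count-injective (λ i → B i Fin.zero) (proj₂ B-bin Fin.zero) s) ⟨
    ∑ (λ i → 𝟙 (B i Fin.zero ≟ᶠ s)) + occ D s
      ≡⟨ ∑-distrib-+ (λ i → 𝟙 (B i Fin.zero ≟ᶠ s)) _ ⟨
    occ B s
      ≡⟨ occ-latin B B-bin s ⟩
    m ∎
    where open ≡-Reasoning

  D-replication : EquiOrNearEqui D
  -- A symbol missing from column 0 of B lies in column 0 of A, so then k ≥ 1 and m ≤ n′.
  D-replication s with inCol? B Fin.zero s | inCol? A Fin.zero s | complementary Fin.zero s | D-occ s
  ... | yes _ | _ | _ | occ+1≡m =
    subst (λ x → FloorOrCeil x (m * n′) (suc n′)) (sym (cong pred (trans (+-comm 1 (occ D s)) occ+1≡m)))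
          (floorOrCeil-pred (subst (m ≤_) k+m≡n (m≤n+m m k)))
  ... | no _ | yes (i , _) | _ | occ+0≡m =
    subst (λ x → FloorOrCeil x (m * n′) (suc n′)) (sym (trans (sym (+-identityʳ (occ D s))) occ+0≡m))
          (floorOrCeil-ceil (≤-pred (subst (suc m ≤_) k+m≡n (+-monoˡ-≤ m (≤-trans (s≤s z≤n) (Finₚ.toℕ<n i))))))
  ... | no _ | no _ | () | _

  D-rc∩ : ∀ i j → rc∩ D i j + 𝟙 (inCol? B (Fin.suc j) (B i Fin.zero)) ≡ m
  D-rc∩ i j = begin
    rc∩ D i j + c (B i Fin.zero)
      ≡⟨ cong₂ _+_ (∑-cong λ s → 𝟙-×-dec (inRow? D i s) (inCol? D j s)) (sym (∑-δ (B i Fin.zero) c)) ⟩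
    ∑ (λ s → r s * c s) + ∑ (λ s → δ s * c s)
      ≡⟨ ∑-distrib-+ (λ s → r s * c s) (λ s → δ s * c s) ⟨
    ∑ (λ s → r s * c s + δ s * c s)
      ≡⟨ ∑-cong (λ s → trans (sym (*-distribʳ-+ (c s) (r s) (δ s)))
                             (trans (cong (_* c s) (D-row-split i s)) (*-identityˡ (c s)))) ⟩
    ∑ c
      ≡⟨ column-size B B-bin (Fin.suc j) ⟩
    m ∎
    where
    open ≡-Reasoning
    r c δ : Fin (suc n′) → ℕ
    r s = 𝟙 (inRow? D i s)
    c s = 𝟙 (inCol? B (Fin.suc j) s)
    δ s = 𝟙 (B i Fin.zero ≟ᶠ s)

  D-rr∩ : ∀ i i′ → i ≢ i′ → rr∩ D i i′ + 2 ≡ suc n′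
  D-rr∩ i i′ i≢i′ = begin
    rr∩ D i i′ + 2
      ≡⟨ cong₂ _+_ (∑-cong λ s → 𝟙-×-dec (inRow? D i s) (inRow? D i′ s))
                   (sym (cong₂ _+_ (∑-δ-1 (B i Fin.zero)) (∑-δ-1 (B i′ Fin.zero)))) ⟩
    ∑ (λ s → r s * r′ s) + (∑ δ + ∑ δ′)
      ≡⟨ ∑-complement-∩ δ r δ′ r′ (λ s → trans (+-comm (δ s) (r s)) (D-row-split i s))
                                  (λ s → trans (+-comm (δ′ s) (r′ s)) (D-row-split i′ s)) ⟩
    suc n′ + ∑ (λ s → δ s * δ′ s)
      ≡⟨ cong (suc n′ +_) (trans (∑-δ (B i Fin.zero) δ′) (𝟙-no _ (i≢i′ ∘ proj₂ B-bin Fin.zero ∘ sym))) ⟩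
    suc n′ + 0
      ≡⟨ +-identityʳ (suc n′) ⟩
    suc n′ ∎
    where
    open ≡-Reasoning
    r r′ δ δ′ : Fin (suc n′) → ℕ
    r s = 𝟙 (inRow? D i s)
    r′ s = 𝟙 (inRow? D i′ s)
    δ s = 𝟙 (B i Fin.zero ≟ᶠ s)
    δ′ s = 𝟙 (B i′ Fin.zero ≟ᶠ s)

  D-nta : IsNearTripleArray D
  D-nta = nearTripleArray-intro D D-bin D-replication
    (λ i j i′ j′ → spread-of-deficits (D-rc∩ i j) (D-rc∩ i′ j′) (𝟙≤1 _))
    (λ i₁ i₂ i₃ i₄ i₁≢i₂ i₃≢i₄ →
       ≡⇒≤1+ (+-cancelʳ-≡ 2 _ _ (trans (D-rr∩ i₁ i₂ i₁≢i₂) (sym (D-rr∩ i₃ i₄ i₃≢i₄)))))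
    (λ j₁ j₂ j₃ j₄ j₁≢j₂ j₃≢j₄ → B-cc-spread (Fin.suc j₁) (Fin.suc j₂) (Fin.suc j₃) (Fin.suc j₄)
                                  (j₁≢j₂ ∘ Finₚ.suc-injective) (j₃≢j₄ ∘ Finₚ.suc-injective))

empty-nearTripleArray : NearTripleArrayExists 0 0 0
empty-nearTripleArray = (λ ()) , record
  { binary = (λ ()) , (λ ())
  ; replication = λ ()
  ; rowCol = λ ()
  ; rowRow = λ ()
  ; colCol = λ ()
  }

lemma5p9 : (k n : ℕ) → NearTripleArrayExists k n n
         → NearTripleArrayExists (n ∸ k) n n × NearTripleArrayExists (n ∸ k) (n ∸ 1) n
lemma5p9 zero zero _ = empty-nearTripleArray , empty-nearTripleArray
lemma5p9 (suc k) zero _ = empty-nearTripleArray , empty-nearTripleArray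
lemma5p9 k (suc n′) (A , A-nta) =
  let B , B-bin , A∦B = Completion.complete A A-bin (suc n′ ∸ k) (≤-reflexive k+m≡n)
      open Complement A A-nta B B-bin A∦B k+m≡n
  in (B , B-nta) , (D , D-nta)
  where
  A-bin : Binary A
  A-bin = IsNearTripleArray.binary A-nta
  k+m≡n : k + (suc n′ ∸ k) ≡ suc n′
  k+m≡n = m+[n∸m]≡n (Finₚ.injective⇒≤ (proj₂ A-bin Fin.zero))
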